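{- Let $G$ be a connected bipartite $(p,q)$-graph and let $f:V(G)\to\{0,1,2,\dots\}$ be a vertex map, extended to edges by $f(xy)=|f(x)-f(y)|$ for $xy\in E(G)$. Define $f_{dual}(w)=\max f(V(G))+\min f(V(G))-f(w)$ for $w\in V(G)$ and $f_{dual}(xy)=|f_{dual}(x)-f_{dual}(y)|$ for $xy\in E(G)$. Define the total map $f^*_{dual}$ by $f^*_{dual}(w)=\max f(V(G))+\min f(V(G))-f(w)$ for $w\in V(G)$ and $f^*_{dual}(xy)=\max f(E(G))+\min f(E(G))-f(xy)$ for $xy\in E(G)$. Then $f$ is a set-ordered graceful labeling of $G$ if and only if $f_{dual}$ is a set-ordered graceful labeling of $G$ and $f^*_{dual}$ is a set-ordered edge-difference total labeling of $G$.
   Context: A $(p,q)$-graph has $p$ vertices and $q$ edges; $[a,b]=\{a,a+1,\dots,b\}$. For a map $\theta$ and a set $S$, $\theta(S)=\{\theta(s):s\in S\}$. A map (vertex or total) on a connected bipartite graph is called set-ordered if the two colour classes of $G$ can be named $X$ and $Y$ so that $\max\theta(X)<\min\theta(Y)$. A set-ordered graceful labeling of $G$ is an injective map $f:V(G)\to\{0,1,\dots\}$ with $f(V(G))\subseteq[0,q]$, $\min f(V(G))=0$, $\{|f(x)-f(y)|:xy\in E(G)\}=[1,q]$, which is set-ordered. A set-ordered edge-difference total labeling of $G$ is a map $g:V(G)\cup E(G)\to\mathbb{Z}$ that is injective on $V(G)$, is set-ordered, and for which there is an integer $k$ with $g(xy)+|g(x)-g(y)|=k$ for every edge $xy\in E(G)$.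 -}

module Defs where

open import Data.Nat using (ℕ; zero; suc; _+_; _∸_; _≤_; _<_; _⊔_; _⊓_; ∣_-_∣)
open import Data.Integer as ℤ using (ℤ; +_)
open import Data.Fin using (Fin; zero; suc)
open import Data.Bool using (Bool; true; false)
open import Data.Product using (_×_; _,_; proj₁; proj₂; ∃; ∃-syntax)
open import Data.Sum using (_⊎_)
open import Relation.Binary.PropositionalEquality using (_≡_; _≢_)
open import Function.Definitions using (Injective)

-- A simple graph with p vertices (Fin p) and q edges (indexed by Fin q).
-- Each edge is an unordered pair {x,y}, stored as an ordered pair; no loops,
-- no multiple edges.
SameEdge : ∀ {p} → Fin p × Fin p → Fin p × Fin p → Set
SameEdge (a , b) (c , d) = (a ≡ c × b ≡ d) ⊎ (a ≡ d × b ≡ c)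

record Graph (p q : ℕ) : Set where
  field
    edge    : Fin q → Fin p × Fin p
    noLoop  : ∀ i → proj₁ (edge i) ≢ proj₂ (edge i)
    noMulti : ∀ i j → SameEdge (edge i) (edge j) → i ≡ j
open Graph public

Adjacent : ∀ {p q} → Graph p q → Fin p → Fin p → Set
Adjacent {q = q} G u v = ∃[ i ] SameEdge (edge G i) (u , v)

data Walk {p q} (G : Graph p q) : Fin p → Fin p → Set where
  here : ∀ {u} → Walk G u u
  step : ∀ {u v w} → Adjacent G u v → Walk G v w → Walk G u w

Connected : ∀ {p q} → Graph p q → Set
Connected G = ∀ u v → Walk G u v

Proper2Colouring : ∀ {p q} → Graph p q → (Fin p → Bool) → Set
Proper2Colouring G c = ∀ i → c (proj₁ (edge G i)) ≢ c (proj₂ (edge G i))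

Bipartite : ∀ {p q} → Graph p q → Set
Bipartite G = ∃[ c ] Proper2Colouring G c

-- set-ordered: the colour classes can be named X, Y with max θ(X) < min θ(Y),
-- i.e. every label on X is below every label on Y.
SetOrdered : ∀ {p q} {A : Set} (_≺_ : A → A → Set) → Graph p q → (Fin p → A) → Set
SetOrdered _≺_ G θ =
  ∃[ c ] (Proper2Colouring G c ×
          (∀ x y → c x ≡ false → c y ≡ true → θ x ≺ θ y))

-- max / min of a finitely indexed family of naturals (0 for the empty family)
maxF : (n : ℕ) → (Fin n → ℕ) → ℕ
maxF zero    g = 0
maxF (suc n) g = g zero ⊔ maxF n (λ i → g (suc i))

minF : (n : ℕ) → (Fin n → ℕ) → ℕ
minF zero          g = 0
minF (suc zero)    g = g zero
minF (suc (suc n)) g = g zero ⊓ minF (suc n) (λ i → g (suc i))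

edgeLabel : ∀ {p q} → Graph p q → (Fin p → ℕ) → Fin q → ℕ
edgeLabel G f i = ∣ f (proj₁ (edge G i)) - f (proj₂ (edge G i)) ∣

SetOrderedGraceful : ∀ {p q} → Graph p q → (Fin p → ℕ) → Set
SetOrderedGraceful {p} {q} G f =
  Injective _≡_ _≡_ f ×
  (∀ v → f v ≤ q) ×
  (∃[ v ] f v ≡ 0) ×
  (∀ i → 1 ≤ edgeLabel G f i × edgeLabel G f i ≤ q) ×
  (∀ k → 1 ≤ k → k ≤ q → ∃[ i ] edgeLabel G f i ≡ k) ×
  SetOrdered _<_ G f

SetOrderedEdgeDifferenceTotal : ∀ {p q} → Graph p q → (Fin p → ℤ) → (Fin q → ℤ) → Set
SetOrderedEdgeDifferenceTotal G gv ge =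
  Injective _≡_ _≡_ gv ×
  SetOrdered ℤ._<_ G gv ×
  ∃[ k ] (∀ i → ge i ℤ.+ (+ ℤ.∣ gv (proj₁ (edge G i)) ℤ.- gv (proj₂ (edge G i)) ∣) ≡ k)

fdual : ∀ {p q} → Graph p q → (Fin p → ℕ) → Fin p → ℕ
fdual {p} G f w = maxF p f + minF p f ∸ f w

fstarV : ∀ {p q} → Graph p q → (Fin p → ℕ) → Fin p → ℤ
fstarV {p} G f w = + (maxF p f + minF p f) ℤ.- + f w

fstarE : ∀ {p q} → Graph p q → (Fin p → ℕ) → Fin q → ℤ
fstarE {p} {q} G f i =
  + (maxF q (edgeLabel G f) + minF q (edgeLabel G f)) ℤ.- + edgeLabel G f i

{-# OPTIONS --safe #-}
-- With N = max f + min f, the maps f and f_dual = N - f sum to N at every vertex. Such a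
-- reflection preserves every difference |f x - f y| (so all edge labels) and injectivity,
-- and reverses the order, so a set-ordering survives with the colour classes swapped. A
-- graceful labeling has min = 0, hence N = max ≤ q and the vertex carrying the maximum
-- receives 0; this transfers gracefulness in both directions. Finally every edge of f*_dual
-- satisfies f*(xy) + |f*(x) - f*(y)| = (K - f(xy)) + f(xy) = K with K = max f(E) + min f(E).
module Submission where

open import Defs
open import Data.Nat using (ℕ)
open import Data.Fin using (Fin)
open import Data.Product using (_×_)
open import Function.Bundles using (_⇔_)

open import Data.Nat using (zero; suc; _+_; _∸_; _≤_; _<_; ∣_-_∣)
open import Data.Nat.Properties
open import Data.Integer as ℤ using (ℤ; +_; +<+)
import Data.Integer.Properties as ℤ
open import Data.Integer.Tactic.RingSolver using (solve-∀)
open import Data.Fin using (zero; suc)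
open import Data.Bool using (not)
open import Data.Bool.Properties using (not-injective)
open import Data.Product using (_,_; proj₁; proj₂; ∃-syntax)
open import Data.Sum using (inj₁; inj₂)
open import Function using (_∘_)
open import Function.Bundles using (mk⇔)
open import Function.Definitions using (Injective)
open import Relation.Binary.PropositionalEquality

g≤maxF : ∀ n g (i : Fin n) → g i ≤ maxF n g
g≤maxF (suc n) g zero    = m≤m⊔n _ _
g≤maxF (suc n) g (suc i) = ≤-trans (g≤maxF n (g ∘ suc) i) (m≤n⊔m _ _)

maxF-attained : ∀ n g → Fin n → ∃[ j ] g j ≡ maxF n g
maxF-attained (suc zero)    g _ = zero , sym (⊔-identityʳ (g zero))
maxF-attained (suc (suc n)) g _
  with ⊔-sel (g zero) (maxF (suc n) (g ∘ suc)) | maxF-attained (suc n) (g ∘ suc) zero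
... | inj₁ g₀-wins   | _          = zero , sym g₀-wins
... | inj₂ rest-wins | j , gj≡max = suc j , trans gj≡max (sym rest-wins)

minF≤g : ∀ n g (i : Fin n) → minF n g ≤ g i
minF≤g (suc zero)    g zero    = ≤-refl
minF≤g (suc (suc n)) g zero    = m⊓n≤m _ _
minF≤g (suc (suc n)) g (suc i) = ≤-trans (m⊓n≤n _ _) (minF≤g (suc n) (g ∘ suc) i)

minF-attained : ∀ n g → Fin n → ∃[ j ] g j ≡ minF n g
minF-attained (suc zero)    g _ = zero , refl
minF-attained (suc (suc n)) g _
  with ⊓-sel (g zero) (minF (suc n) (g ∘ suc)) | minF-attained (suc n) (g ∘ suc) zero
... | inj₁ g₀-wins   | _          = zero , sym g₀-wins
... | inj₂ rest-wins | j , gj≡min = suc j , trans gj≡min (sym rest-wins)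

∣+m-+n∣≡∣m-n∣ : ∀ m n → ℤ.∣ + m ℤ.- + n ∣ ≡ ∣ m - n ∣
∣+m-+n∣≡∣m-n∣ m n with ≤-total m n
... | inj₁ m≤n = begin
  ℤ.∣ + m ℤ.- + n ∣ ≡⟨ cong ℤ.∣_∣ (ℤ.m-n≡m⊖n m n) ⟩
  ℤ.∣ m ℤ.⊖ n ∣     ≡⟨ ℤ.∣⊖∣-≤ m≤n ⟩
  n ∸ m             ≡⟨ m≤n⇒∣m-n∣≡n∸m m≤n ⟨
  ∣ m - n ∣         ∎
  where open ≡-Reasoning
... | inj₂ n≤m = begin
  ℤ.∣ + m ℤ.- + n ∣ ≡⟨ cong ℤ.∣_∣ (ℤ.m-n≡m⊖n m n) ⟩
  ℤ.∣ m ℤ.⊖ n ∣     ≡⟨ ℤ.∣m⊖n∣≡∣n⊖m∣ m n ⟩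
  ℤ.∣ n ℤ.⊖ m ∣     ≡⟨ ℤ.∣⊖∣-≤ n≤m ⟩
  m ∸ n             ≡⟨ m≤n⇒∣n-m∣≡n∸m n≤m ⟨
  ∣ m - n ∣         ∎
  where open ≡-Reasoning

+m-+n≡+[m∸n] : ∀ {m n} → n ≤ m → + m ℤ.- + n ≡ + (m ∸ n)
+m-+n≡+[m∸n] {m} {n} n≤m = trans (ℤ.m-n≡m⊖n m n) (ℤ.⊖-≥ n≤m)

[i-j]+j≡i : ∀ (i j : ℤ) → i ℤ.- j ℤ.+ j ≡ i
[i-j]+j≡i = solve-∀

record Complementary {p} (n : ℕ) (g h : Fin p → ℕ) : Set where
  constructor complementary
  field sum≡ : ∀ w → g w + h w ≡ n

module _ {p} {n} {g h : Fin p → ℕ} (gh : Complementary n g h) where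

  open Complementary gh

  Complementary-sym : Complementary n h g
  Complementary-sym = complementary λ w → trans (+-comm (h w) (g w)) (sum≡ w)

  complement-∣-∣ : ∀ v w → ∣ h v - h w ∣ ≡ ∣ g v - g w ∣
  complement-∣-∣ v w = begin
    ∣ h v - h w ∣                         ≡⟨ ∣m+n-m+o∣≡∣n-o∣ (g v + g w) (h v) (h w) ⟨
    ∣ g v + g w + h v - g v + g w + h w ∣ ≡⟨ cong₂ ∣_-_∣ gv+gw+hv≡n+gw gv+gw+hw≡n+gv ⟩
    ∣ n + g w - n + g v ∣                 ≡⟨ ∣m+n-m+o∣≡∣n-o∣ n (g w) (g v) ⟩
    ∣ g w - g v ∣                         ≡⟨ ∣-∣-comm (g w) (g v) ⟩
    ∣ g v - g w ∣                         ∎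
    where
    open ≡-Reasoning
    gv+gw+hv≡n+gw : g v + g w + h v ≡ n + g w
    gv+gw+hv≡n+gw = begin
      g v + g w + h v   ≡⟨ +-assoc (g v) (g w) (h v) ⟩
      g v + (g w + h v) ≡⟨ cong (λ t → g v + t) (+-comm (g w) (h v)) ⟩
      g v + (h v + g w) ≡⟨ +-assoc (g v) (h v) (g w) ⟨
      g v + h v + g w   ≡⟨ cong (λ t → t + g w) (sum≡ v) ⟩
      n + g w           ∎
    gv+gw+hw≡n+gv : g v + g w + h w ≡ n + g v
    gv+gw+hw≡n+gv = begin
      g v + g w + h w   ≡⟨ +-assoc (g v) (g w) (h w) ⟩
      g v + (g w + h w) ≡⟨ cong (λ t → g v + t) (sum≡ w) ⟩
      g v + n           ≡⟨ +-comm (g v) n ⟩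
      n + g v           ∎

  complement-injective : Injective _≡_ _≡_ g → Injective _≡_ _≡_ h
  complement-injective g-inj {v} {w} hv≡hw =
    g-inj (+-cancelʳ-≡ (h w) (g v) (g w)
      (trans (cong (λ t → g v + t) (sym hv≡hw)) (trans (sum≡ v) (sym (sum≡ w)))))

  complement-reverses-< : ∀ {v w} → g v < g w → h w < h v
  complement-reverses-< {v} {w} gv<gw =
    +-cancelˡ-< (g w) (h w) (h v)
      (subst (λ t → t < g w + h v) (trans (sum≡ v) (sym (sum≡ w))) (+-monoˡ-< (h v) gv<gw))

  complement-≤ : ∀ w → h w ≤ n
  complement-≤ w = subst (h w ≤_) (sum≡ w) (m≤n+m (h w) (g w))

  complement-of-0 : ∀ {w} → g w ≡ 0 → h w ≡ n
  complement-of-0 {w} gw≡0 = trans (cong (λ t → t + h w) (sym gw≡0)) (sum≡ w)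

  complement-of-n : ∀ {w} → g w ≡ n → h w ≡ 0
  complement-of-n {w} gw≡n =
    +-cancelˡ-≡ (g w) (h w) 0 (trans (sum≡ w) (trans (sym gw≡n) (sym (+-identityʳ (g w)))))

module _ {p q} (G : Graph p q) where

  SetOrdered-reverse : ∀ {A B : Set} (_≺_ : A → A → Set) (_≺′_ : B → B → Set) {θ θ′} →
                       (∀ {x y} → θ x ≺ θ y → θ′ y ≺′ θ′ x) →
                       SetOrdered _≺_ G θ → SetOrdered _≺′_ G θ′
  SetOrdered-reverse _ _ reverse (c , proper , ordered) =
    not ∘ c , (λ i → proper i ∘ not-injective) ,
    λ x y cx cy → reverse (ordered y x (not-injective cy) (not-injective cx))

  edgeLabel-complement : ∀ {n g h} → Complementary n g h → ∀ i → edgeLabel G h i ≡ edgeLabel G g i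
  edgeLabel-complement gh i = complement-∣-∣ gh _ _

  SetOrderedGraceful-complement : ∀ {n g h} → Complementary n g h → ∃[ v ] g v ≡ n →
                                  SetOrderedGraceful G g → SetOrderedGraceful G h
  SetOrderedGraceful-complement {n} {g} {h} gh (top , gtop≡n) (inj , bounded , _ , labels , onto , ordered) =
    complement-injective gh inj ,
    (λ w → ≤-trans (complement-≤ gh w) n≤q) ,
    (top , complement-of-n gh gtop≡n) ,
    (λ i → subst (λ l → 1 ≤ l × l ≤ q) (sym (sameLabel i)) (labels i)) ,
    (λ k 1≤k k≤q → let (i , gi≡k) = onto k 1≤k k≤q in i , trans (sameLabel i) gi≡k) ,
    SetOrdered-reverse _<_ _<_ (complement-reverses-< gh) ordered
    where
    n≤q : n ≤ q
    n≤q = subst (_≤ q) gtop≡n (bounded top)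
    sameLabel : ∀ i → edgeLabel G h i ≡ edgeLabel G g i
    sameLabel = edgeLabel-complement gh

  module _ (f : Fin p → ℕ) where

    private
      N : ℕ
      N = maxF p f + minF p f

    f≤N : ∀ w → f w ≤ N
    f≤N w = ≤-trans (g≤maxF p f w) (m≤m+n _ _)

    fdual-complementary : Complementary N f (fdual G f)
    fdual-complementary = complementary λ w → m+[n∸m]≡n (f≤N w)

    SetOrderedGraceful-fdual : SetOrderedGraceful G f → SetOrderedGraceful G (fdual G f)
    SetOrderedGraceful-fdual f-graceful@(_ , _ , (v₀ , fv₀≡0) , _) =
      SetOrderedGraceful-complement fdual-complementary (top , ftop≡N) f-graceful
      where
      min≡0 : minF p f ≡ 0
      min≡0 = n≤0⇒n≡0 (subst (minF p f ≤_) fv₀≡0 (minF≤g p f v₀))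
      top : Fin p
      top = proj₁ (maxF-attained p f v₀)
      ftop≡N : f top ≡ N
      ftop≡N = begin
        f top           ≡⟨ proj₂ (maxF-attained p f v₀) ⟩
        maxF p f        ≡⟨ +-identityʳ (maxF p f) ⟨
        maxF p f + 0    ≡⟨ cong (λ t → maxF p f + t) min≡0 ⟨
        N               ∎
        where open ≡-Reasoning

    SetOrderedGraceful-from-fdual : SetOrderedGraceful G (fdual G f) → SetOrderedGraceful G f
    SetOrderedGraceful-from-fdual d-graceful@(_ , _ , (v₀ , dv₀≡0) , _) =
      SetOrderedGraceful-complement dual-f (bottom , complement-of-0 fdual-complementary fbottom≡0) d-graceful
      where
      dual-f : Complementary N (fdual G f) f
      dual-f = Complementary-sym fdual-complementary
      -- f v₀ = max + min while f v₀ ≤ max, so min = 0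
      min≡0 : minF p f ≡ 0
      min≡0 = n≤0⇒n≡0 (+-cancelˡ-≤ (maxF p f) _ 0
                (subst₂ _≤_ (complement-of-0 dual-f dv₀≡0) (sym (+-identityʳ _)) (g≤maxF p f v₀)))
      bottom : Fin p
      bottom = proj₁ (minF-attained p f v₀)
      fbottom≡0 : f bottom ≡ 0
      fbottom≡0 = trans (proj₂ (minF-attained p f v₀)) min≡0

    fstarV≡fdual : ∀ w → fstarV G f w ≡ + fdual G f w
    fstarV≡fdual w = +m-+n≡+[m∸n] (f≤N w)

    fstarV-distance : ∀ v w → ℤ.∣ fstarV G f v ℤ.- fstarV G f w ∣ ≡ ∣ f v - f w ∣
    fstarV-distance v w = begin
      ℤ.∣ fstarV G f v ℤ.- fstarV G f w ∣       ≡⟨ cong₂ (λ a b → ℤ.∣ a ℤ.- b ∣) (fstarV≡fdual v) (fstarV≡fdual w) ⟩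
      ℤ.∣ + fdual G f v ℤ.- + fdual G f w ∣     ≡⟨ ∣+m-+n∣≡∣m-n∣ (fdual G f v) (fdual G f w) ⟩
      ∣ fdual G f v - fdual G f w ∣             ≡⟨ complement-∣-∣ fdual-complementary v w ⟩
      ∣ f v - f w ∣                             ∎
      where open ≡-Reasoning

    fstarV-injective : Injective _≡_ _≡_ f → Injective _≡_ _≡_ (fstarV G f)
    fstarV-injective f-inj {v} {w} e =
      complement-injective fdual-complementary f-inj
        (ℤ.+-injective (trans (sym (fstarV≡fdual v)) (trans e (fstarV≡fdual w))))

    fstarV-reverses-< : ∀ {v w} → f v < f w → fstarV G f w ℤ.< fstarV G f v
    fstarV-reverses-< {v} {w} fv<fw =
      subst₂ ℤ._<_ (sym (fstarV≡fdual w)) (sym (fstarV≡fdual v))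
        (+<+ (complement-reverses-< fdual-complementary fv<fw))

    fstar-edgeDifferenceTotal : Injective _≡_ _≡_ f → SetOrdered _<_ G f →
                                SetOrderedEdgeDifferenceTotal G (fstarV G f) (fstarE G f)
    fstar-edgeDifferenceTotal f-inj f-ordered =
      fstarV-injective f-inj ,
      SetOrdered-reverse _<_ ℤ._<_ fstarV-reverses-< f-ordered ,
      (+ K , λ i → trans (cong (λ d → fstarE G f i ℤ.+ + d) (fstarV-distance _ _))
                         ([i-j]+j≡i (+ K) (+ edgeLabel G f i)))
      where
      K : ℕ
      K = maxF q (edgeLabel G f) + minF q (edgeLabel G f)

mainTheorem1 : ∀ {p q} (G : Graph p q) → Connected G → Bipartite G →
               (f : Fin p → ℕ) →
               SetOrderedGraceful G f ⇔
                 (SetOrderedGraceful G (fdual G f) ×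
                  SetOrderedEdgeDifferenceTotal G (fstarV G f) (fstarE G f))
mainTheorem1 G _ _ f = mk⇔
  (λ f-graceful@(f-inj , _ , _ , _ , _ , f-ordered) →
     SetOrderedGraceful-fdual G f f-graceful , fstar-edgeDifferenceTotal G f f-inj f-ordered)
  (SetOrderedGraceful-from-fdual G f ∘ proj₁)
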